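{- Let $p:\mathrm{GF}(2)^n\to\mathrm{GF}(2)$ be a Boolean function and let $i\neq j$. If $H_i\cdot H_j(-1)^p$ is flat, then $x_ix_j$ is a term of the algebraic normal form of $p$ and no other term of $p$ is divisible by $x_ix_j$ (so $ij$ is an edge of the hypergraph of $p$ on which pivoting is permitted), and $H_iH_j(-1)^p=(-1)^{p_{iji}}$, where, writing $p=x_ix_j+x_i\mathcal N_i+x_j\mathcal N_j+R$ with $\mathcal N_i,\mathcal N_j,R$ not depending on $x_i,x_j$, $p_{iji}=x_ix_j+x_i\mathcal N_j+x_j\mathcal N_i+\mathcal N_i\mathcal N_j+R$ is the pivot of $p$ on $ij$.
   Context: $(-1)^p\in\mathbb C^{2^n}$ has entries $(-1)^{p(x)}$, $x\in\mathrm{GF}(2)^n$. A vector is flat if all its entries have absolute value $1$. $H=\frac1{\sqrt2}\begin{pmatrix}1&1\\1&-1\end{pmatrix}$ and $H_k$ is the $n$-fold tensor product with $H$ in the factor corresponding to $x_k$ and the $2\times2$ identity elsewhere. The hypergraph of $p$ has the variables as vertices and the monomials of degree at least $2$ of the algebraic normal form of $p$ as edges. -}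

module Defs where

open import Data.Bool using (Bool; true; false; _xor_; _∧_; if_then_else_)
open import Data.Nat using (ℕ; zero; suc)
open import Data.Fin using (Fin)
open import Data.Vec using (Vec; []; _∷_; lookup; _[_]≔_)
open import Data.Fin.Subset using (Subset; ⁅_⁆; _∪_)
open import Data.Rational using (ℚ; ½; 1ℚ; -_; _+_; _*_; ∣_∣)
open import Relation.Binary.PropositionalEquality using (_≡_)

-- A point of GF(2)^n is a Vec Bool n (true = 1, false = 0; xor = +, ∧ = ·).
-- A Boolean function p : GF(2)^n → GF(2).
BoolFn : ℕ → Set
BoolFn n = Vec Bool n → Bool

-- A monomial  ∏_{k ∈ m} x_k  is identified with its variable set m : Subset n.
-- XOR of f x over all points x ⊆ m (i.e. x ≤ m coordinatewise).
xorBelow : ∀ {n} → Subset n → (Vec Bool n → Bool) → Bool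
xorBelow {zero}  []          f = f []
xorBelow {suc n} (false ∷ m) f = xorBelow m (λ x → f (false ∷ x))
xorBelow {suc n} (true ∷ m)  f =
  xorBelow m (λ x → f (false ∷ x)) xor xorBelow m (λ x → f (true ∷ x))

-- Coefficient of the monomial m in the algebraic normal form of p
-- (Möbius transform: a_m = ⊕_{x ⊆ m} p(x)).
anf : ∀ {n} → BoolFn n → Subset n → Bool
anf p m = xorBelow m p

IsTerm : ∀ {n} → BoolFn n → Subset n → Set
IsTerm p m = anf p m ≡ true

pairMon : ∀ {n} → Fin n → Fin n → Subset n
pairMon i j = ⁅ i ⁆ ∪ ⁅ j ⁆

sgn : Bool → ℚ
sgn b = if b then - 1ℚ else 1ℚ

-- vectors in C^{2^n} that occur here have rational entries
Vector : ℕ → Set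
Vector n = Vec Bool n → ℚ

signVec : ∀ {n} → BoolFn n → Vector n
signVec p x = sgn (p x)

-- unnormalised Hadamard on factor k:  (H'_k v)(x) = Σ_b (-1)^{x_k b} v(x[k:=b]),
-- so that H_k = (1/√2) H'_k.
H' : ∀ {n} → Fin n → Vector n → Vector n
H' k v x = sgn (lookup x k ∧ false) * v (x [ k ]≔ false)
         + sgn (lookup x k ∧ true)  * v (x [ k ]≔ true)

-- H_i · H_j = (1/√2)^2 H'_i H'_j = ½ H'_i H'_j
HH : ∀ {n} → Fin n → Fin n → Vector n → Vector n
HH i j v x = ½ * H' i (H' j v) x

Flat : ∀ {n} → Vector n → Set
Flat v = ∀ x → ∣ v x ∣ ≡ 1ℚ

Indep : ∀ {n} → Fin n → Fin n → BoolFn n → Set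
Indep i j f = ∀ x a b → f ((x [ i ]≔ a) [ j ]≔ b) ≡ f x

decomp : ∀ {n} → Fin n → Fin n → (Ni Nj R : BoolFn n) → BoolFn n
decomp i j Ni Nj R x =
  ((lookup x i ∧ lookup x j) xor (lookup x i ∧ Ni x)) xor ((lookup x j ∧ Nj x) xor R x)

pivot : ∀ {n} → Fin n → Fin n → (Ni Nj R : BoolFn n) → BoolFn n
pivot i j Ni Nj R x =
  ((lookup x i ∧ lookup x j) xor (lookup x i ∧ Nj x))
    xor ((lookup x j ∧ Ni x) xor ((Ni x ∧ Nj x) xor R x))

-- Everything happens on the (x_i, x_j)-plane through a point x. There H_i H_j (-1)^p is the
-- two-variable Gauss sum ½ Σ_{a,b} (-1)^{x_i a + x_j b + p}, of absolute value 1 exactly when the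
-- mixed second difference of p on the plane is 1. That difference is the derivative ∂_i ∂_j p,
-- whose ANF coefficients are those of the monomials of p divisible by x_i x_j; so it is constantly 1
-- iff x_i x_j is the only such monomial. Given the decomposition of p, the exponent on the plane is
-- ab + au + bv + R with u = x_i + N_i, v = x_j + N_j, whose Gauss sum is (-1)^{uv + R};
-- expanding uv + R gives the pivot.
module Submission where

open import Defs
open import Data.Nat using (ℕ; zero; suc)
open import Data.Bool using (Bool; true; false; _xor_; _∧_)
open import Data.Bool.Properties using (xor-same)
open import Data.Bool.Solver using (module xor-∧-Solver)
open import Data.Fin using (Fin; zero; suc)
open import Data.Fin.Subset using (Subset; _∈_; ⊥; ⁅_⁆; _∪_)
open import Data.Fin.Subset.Properties using (x∈⁅x⁆; x∈p∪q⁺; ∪-identityˡ; ∪-identityʳ)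
open import Data.Vec using (Vec; []; _∷_; lookup; _[_]≔_; here; there; head; tail)
open import Data.Vec.Properties using ([]≔-commutes; []≔-minimal; lookup∘update; lookup∘update′)
open import Data.Rational using (ℚ; ½; 1ℚ; _+_; _*_; ∣_∣)
open import Data.Rational.Properties using (*-distribˡ-+)
open import Data.Product using (_×_; _,_)
open import Data.Sum using (inj₁; inj₂)
open import Data.Empty using (⊥-elim)
open import Function using (_∘_)
open import Relation.Binary.PropositionalEquality
  using (_≡_; _≢_; refl; sym; trans; cong; cong₂; module ≡-Reasoning)

open xor-∧-Solver using (solve; _:=_; _:+_; _:*_; con)
open ≡-Reasoning

sgn-xor : ∀ a b → sgn (a xor b) ≡ sgn a * sgn b
sgn-xor false false = refl
sgn-xor false true  = refl
sgn-xor true  false = refl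
sgn-xor true  true  = refl

gaussSum : (Bool → Bool → Bool) → ℚ
gaussSum e = ½ * ((sgn (e false false) + sgn (e false true)) + (sgn (e true false) + sgn (e true true)))

Δ² : (Bool → Bool → Bool) → Bool
Δ² e = (e false false xor e false true) xor (e true false xor e true true)

gaussSum-cong : ∀ {e e′} → (∀ a b → e a b ≡ e′ a b) → gaussSum e ≡ gaussSum e′
gaussSum-cong e≡e′ =
  cong (½ *_) (cong₂ _+_ (cong₂ _+_ (cong sgn (e≡e′ false false)) (cong sgn (e≡e′ false true)))
                         (cong₂ _+_ (cong sgn (e≡e′ true false)) (cong sgn (e≡e′ true true))))

∣gaussSum∣≡1⇒Δ²≡true : ∀ e → ∣ gaussSum e ∣ ≡ 1ℚ → Δ² e ≡ true
∣gaussSum∣≡1⇒Δ²≡true e = odd (e false false) (e false true) (e true false) (e true true)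
  where
  odd : ∀ a b c d → ∣ ½ * ((sgn a + sgn b) + (sgn c + sgn d)) ∣ ≡ 1ℚ → (a xor b) xor (c xor d) ≡ true
  odd false false false false ()
  odd false false false true  _ = refl
  odd false false true  false _ = refl
  odd false false true  true  ()
  odd false true  false false _ = refl
  odd false true  false true  ()
  odd false true  true  false ()
  odd false true  true  true  _ = refl
  odd true  false false false _ = refl
  odd true  false false true  ()
  odd true  false true  false ()
  odd true  false true  true  _ = refl
  odd true  true  false false ()
  odd true  true  false true  _ = refl
  odd true  true  true  false _ = refl
  odd true  true  true  true  ()

gaussSum-quadratic : ∀ u v r →
  gaussSum (λ a b → ((a ∧ b) xor (a ∧ u)) xor ((b ∧ v) xor r)) ≡ sgn ((u ∧ v) xor r)
gaussSum-quadratic false false false = refl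
gaussSum-quadratic false false true  = refl
gaussSum-quadratic false true  false = refl
gaussSum-quadratic false true  true  = refl
gaussSum-quadratic true  false false = refl
gaussSum-quadratic true  false true  = refl
gaussSum-quadratic true  true  false = refl
gaussSum-quadratic true  true  true  = refl

Δ²-affine-invariant : ∀ s t e → Δ² (λ a b → (s ∧ a) xor ((t ∧ b) xor e a b)) ≡ Δ² e
Δ²-affine-invariant s t e =
  solve 6 (λ s t e₀₀ e₀₁ e₁₀ e₁₁ →
      (((s :* con false) :+ ((t :* con false) :+ e₀₀)) :+ ((s :* con false) :+ ((t :* con true) :+ e₀₁)))
      :+ (((s :* con true) :+ ((t :* con false) :+ e₁₀)) :+ ((s :* con true) :+ ((t :* con true) :+ e₁₁)))
      := (e₀₀ :+ e₀₁) :+ (e₁₀ :+ e₁₁))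
    refl s t (e false false) (e false true) (e true false) (e true true)

xor-interchange : ∀ a b c d → (a xor b) xor (c xor d) ≡ (a xor c) xor (b xor d)
xor-interchange = solve 4 (λ a b c d → (a :+ b) :+ (c :+ d) := (a :+ c) :+ (b :+ d)) refl

phases-absorbed : ∀ s t a b u v r →
  (s ∧ a) xor ((t ∧ b) xor (((a ∧ b) xor (a ∧ u)) xor ((b ∧ v) xor r)))
    ≡ ((a ∧ b) xor (a ∧ (s xor u))) xor ((b ∧ (t xor v)) xor r)
phases-absorbed = solve 7 (λ s t a b u v r →
  (s :* a) :+ ((t :* b) :+ (((a :* b) :+ (a :* u)) :+ ((b :* v) :+ r)))
  := ((a :* b) :+ (a :* (s :+ u))) :+ ((b :* (t :+ v)) :+ r)) refl

pivot-expanded : ∀ s t u v r →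
  ((s xor u) ∧ (t xor v)) xor r ≡ ((s ∧ t) xor (s ∧ v)) xor ((t ∧ u) xor ((u ∧ v) xor r))
pivot-expanded = solve 5 (λ s t u v r →
  ((s :+ u) :* (t :+ v)) :+ r := ((s :* t) :+ (s :* v)) :+ ((t :* u) :+ ((u :* v) :+ r))) refl

∂ : ∀ {n} → Fin n → BoolFn n → BoolFn n
∂ k f x = f (x [ k ]≔ false) xor f (x [ k ]≔ true)

xorBelow-cong : ∀ {n} (m : Subset n) {f g : BoolFn n} → (∀ x → f x ≡ g x) → xorBelow m f ≡ xorBelow m g
xorBelow-cong []          f≡g = f≡g []
xorBelow-cong (false ∷ m) f≡g = xorBelow-cong m (f≡g ∘ (false ∷_))
xorBelow-cong (true ∷ m)  f≡g =
  cong₂ _xor_ (xorBelow-cong m (f≡g ∘ (false ∷_))) (xorBelow-cong m (f≡g ∘ (true ∷_)))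

xorBelow-xor : ∀ {n} (m : Subset n) (f g : BoolFn n) →
  xorBelow m (λ x → f x xor g x) ≡ xorBelow m f xor xorBelow m g
xorBelow-xor []          f g = refl
xorBelow-xor (false ∷ m) f g = xorBelow-xor m _ _
xorBelow-xor (true ∷ m)  f g =
  trans (cong₂ _xor_ (xorBelow-xor m _ _) (xorBelow-xor m _ _))
        (xor-interchange (xorBelow m (f ∘ (false ∷_))) (xorBelow m (g ∘ (false ∷_)))
                         (xorBelow m (f ∘ (true ∷_)))  (xorBelow m (g ∘ (true ∷_))))

xorBelow-∂ : ∀ {n} (m : Subset n) {k : Fin n} → k ∈ m → (f : BoolFn n) →
  xorBelow m f ≡ xorBelow (m [ k ]≔ false) (∂ k f)
xorBelow-∂ (true ∷ m)  here       f = sym (xorBelow-xor m _ _)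
xorBelow-∂ (false ∷ m) (there k∈m) f = xorBelow-∂ m k∈m _
xorBelow-∂ (true ∷ m)  (there k∈m) f = cong₂ _xor_ (xorBelow-∂ m k∈m _) (xorBelow-∂ m k∈m _)

xorBelow-⊥ : ∀ {n} (f : BoolFn n) → xorBelow ⊥ f ≡ f ⊥
xorBelow-⊥ {zero}  f = refl
xorBelow-⊥ {suc n} f = xorBelow-⊥ (f ∘ (false ∷_))

xorBelow-const : ∀ {n} (m : Subset n) b → m ≢ ⊥ → xorBelow m (λ _ → b) ≡ false
xorBelow-const []          b m≢⊥ = ⊥-elim (m≢⊥ refl)
xorBelow-const (false ∷ m) b m≢⊥ = xorBelow-const m b (m≢⊥ ∘ cong (false ∷_))
xorBelow-const (true ∷ m)  b m≢⊥ = xor-same (xorBelow m (λ _ → b))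

⁅x⁆-remove : ∀ {n} (x : Fin n) → ⁅ x ⁆ [ x ]≔ false ≡ ⊥
⁅x⁆-remove zero    = refl
⁅x⁆-remove (suc x) = cong (false ∷_) (⁅x⁆-remove x)

remove≡⊥⇒≡⁅x⁆ : ∀ {n} (m : Subset n) {x : Fin n} → x ∈ m → m [ x ]≔ false ≡ ⊥ → m ≡ ⁅ x ⁆
remove≡⊥⇒≡⁅x⁆ (true ∷ m) here        eq = cong (true ∷_) (cong tail eq)
remove≡⊥⇒≡⁅x⁆ (b ∷ m)    (there x∈m) eq = cong₂ _∷_ (cong head eq) (remove≡⊥⇒≡⁅x⁆ m x∈m (cong tail eq))

suc-injective-≢ : ∀ {n} {x y : Fin n} → suc x ≢ suc y → x ≢ y
suc-injective-≢ sx≢sy = sx≢sy ∘ cong suc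

pairMon-remove : ∀ {n} {i j : Fin n} → i ≢ j → (pairMon i j [ i ]≔ false) [ j ]≔ false ≡ ⊥
pairMon-remove {i = zero}  {zero}  i≢j = ⊥-elim (i≢j refl)
pairMon-remove {i = zero}  {suc j} i≢j =
  cong (false ∷_) (trans (cong (_[ j ]≔ false) (∪-identityˡ ⁅ j ⁆)) (⁅x⁆-remove j))
pairMon-remove {i = suc i} {zero}  i≢j =
  cong (false ∷_) (trans (cong (_[ i ]≔ false) (∪-identityʳ ⁅ i ⁆)) (⁅x⁆-remove i))
pairMon-remove {i = suc i} {suc j} i≢j = cong (false ∷_) (pairMon-remove (suc-injective-≢ i≢j))

remove-pair≡⊥⇒≡pairMon : ∀ {n} (m : Subset n) {i j : Fin n} → i ≢ j → i ∈ m → j ∈ m →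
  (m [ i ]≔ false) [ j ]≔ false ≡ ⊥ → m ≡ pairMon i j
remove-pair≡⊥⇒≡pairMon m {zero} {zero} i≢j _ _ _ = ⊥-elim (i≢j refl)
remove-pair≡⊥⇒≡pairMon (true ∷ m) {zero} {suc j} _ here (there j∈m) eq =
  cong (true ∷_) (trans (remove≡⊥⇒≡⁅x⁆ m j∈m (cong tail eq)) (sym (∪-identityˡ ⁅ j ⁆)))
remove-pair≡⊥⇒≡pairMon (true ∷ m) {suc i} {zero} _ (there i∈m) here eq =
  cong (true ∷_) (trans (remove≡⊥⇒≡⁅x⁆ m i∈m (cong tail eq)) (sym (∪-identityʳ ⁅ i ⁆)))
remove-pair≡⊥⇒≡pairMon (b ∷ m) {suc i} {suc j} i≢j (there i∈m) (there j∈m) eq =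
  cong₂ _∷_ (cong head eq) (remove-pair≡⊥⇒≡pairMon m (suc-injective-≢ i≢j) i∈m j∈m (cong tail eq))

plane : ∀ {n} → Fin n → Fin n → Vec Bool n → Bool → Bool → Vec Bool n
plane i j x a b = (x [ i ]≔ a) [ j ]≔ b

module _ {n : ℕ} {i j : Fin n} (i≢j : i ≢ j) where

  HH-gaussSum : ∀ p x → HH i j (signVec p) x
    ≡ gaussSum (λ a b → (lookup x i ∧ a) xor ((lookup x j ∧ b) xor p (plane i j x a b)))
  HH-gaussSum p x = cong (½ *_) (cong₂ _+_ (row false) (row true))
    where
    s t : Bool
    s = lookup x i
    t = lookup x j
    e : Bool → Bool → Bool
    e a b = (t ∧ b) xor p (plane i j x a b)
    row : ∀ a → sgn (s ∧ a) * H' j (signVec p) (x [ i ]≔ a) ≡ sgn ((s ∧ a) xor e a false) + sgn ((s ∧ a) xor e a true)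
    row a = begin
      sgn (s ∧ a) * H' j (signVec p) (x [ i ]≔ a)
        ≡⟨ cong (λ t′ → sgn (s ∧ a) * (sgn (t′ ∧ false) * sgn (p (plane i j x a false))
                                      + sgn (t′ ∧ true) * sgn (p (plane i j x a true))))
                (lookup∘update′ (i≢j ∘ sym) x a) ⟩
      sgn (s ∧ a) * (sgn (t ∧ false) * sgn (p (plane i j x a false)) + sgn (t ∧ true) * sgn (p (plane i j x a true)))
        ≡⟨ cong (sgn (s ∧ a) *_) (sym (cong₂ _+_ (sgn-xor (t ∧ false) _) (sgn-xor (t ∧ true) _))) ⟩
      sgn (s ∧ a) * (sgn (e a false) + sgn (e a true))
        ≡⟨ *-distribˡ-+ (sgn (s ∧ a)) _ _ ⟩
      sgn (s ∧ a) * sgn (e a false) + sgn (s ∧ a) * sgn (e a true)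
        ≡⟨ sym (cong₂ _+_ (sgn-xor (s ∧ a) _) (sgn-xor (s ∧ a) _)) ⟩
      sgn ((s ∧ a) xor e a false) + sgn ((s ∧ a) xor e a true)
        ∎

  ∂∂-Δ² : ∀ p x → ∂ j (∂ i p) x ≡ Δ² (λ a b → p (plane i j x a b))
  ∂∂-Δ² p x = begin
    ∂ j (∂ i p) x
      ≡⟨ xor-interchange (q false false) (q true false) (q false true) (q true true) ⟩
    (q false false xor q false true) xor (q true false xor q true true)
      ≡⟨ cong₂ _xor_ (cong₂ _xor_ (commute false false) (commute false true))
                     (cong₂ _xor_ (commute true false) (commute true true)) ⟩
    Δ² (λ a b → p (plane i j x a b))
      ∎
    where
    q : Bool → Bool → Bool
    q a b = p ((x [ j ]≔ b) [ i ]≔ a)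
    commute : ∀ a b → q a b ≡ p (plane i j x a b)
    commute a b = cong p ([]≔-commutes x j i (i≢j ∘ sym))

  anf-∂∂ : ∀ p (m : Subset n) → i ∈ m → j ∈ m →
    anf p m ≡ xorBelow ((m [ i ]≔ false) [ j ]≔ false) (∂ j (∂ i p))
  anf-∂∂ p m i∈m j∈m =
    trans (xorBelow-∂ m i∈m p) (xorBelow-∂ (m [ i ]≔ false) ([]≔-minimal m j i (i≢j ∘ sym) j∈m) (∂ i p))

  flat⇒∂∂≡true : ∀ p → Flat (HH i j (signVec p)) → ∀ x → ∂ j (∂ i p) x ≡ true
  flat⇒∂∂≡true p flat x = begin
    ∂ j (∂ i p) x                      ≡⟨ ∂∂-Δ² p x ⟩
    Δ² q                               ≡⟨ Δ²-affine-invariant (lookup x i) (lookup x j) q ⟨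
    Δ² twisted-q                       ≡⟨ ∣gaussSum∣≡1⇒Δ²≡true twisted-q ∣gaussSum∣≡1 ⟩
    true                               ∎
    where
    q twisted-q : Bool → Bool → Bool
    q a b = p (plane i j x a b)
    twisted-q a b = (lookup x i ∧ a) xor ((lookup x j ∧ b) xor q a b)
    ∣gaussSum∣≡1 : ∣ gaussSum twisted-q ∣ ≡ 1ℚ
    ∣gaussSum∣≡1 = trans (cong ∣_∣ (sym (HH-gaussSum p x))) (flat x)

  decomp-plane : ∀ {Ni Nj R : BoolFn n} → Indep i j Ni → Indep i j Nj → Indep i j R →
    ∀ x a b → decomp i j Ni Nj R (plane i j x a b) ≡ ((a ∧ b) xor (a ∧ Ni x)) xor ((b ∧ Nj x) xor R x)
  decomp-plane {Ni} {Nj} {R} Ni-indep Nj-indep R-indep x a b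
    rewrite Ni-indep x a b | Nj-indep x a b | R-indep x a b
          | lookup∘update j (x [ i ]≔ a) b | lookup∘update′ i≢j (x [ i ]≔ a) b | lookup∘update i x a = refl

  anf-pair≡xorBelow-true : ∀ {p} → Flat (HH i j (signVec p)) → ∀ m → i ∈ m → j ∈ m →
    anf p m ≡ xorBelow ((m [ i ]≔ false) [ j ]≔ false) (λ _ → true)
  anf-pair≡xorBelow-true {p} flat m i∈m j∈m =
    trans (anf-∂∂ p m i∈m j∈m) (xorBelow-cong ((m [ i ]≔ false) [ j ]≔ false) (flat⇒∂∂≡true p flat))

  flat⇒IsTerm-pairMon : ∀ {p} → Flat (HH i j (signVec p)) → IsTerm p (pairMon i j)
  flat⇒IsTerm-pairMon {p} flat = begin
    anf p (pairMon i j)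
      ≡⟨ anf-pair≡xorBelow-true flat (pairMon i j) (x∈p∪q⁺ (inj₁ (x∈⁅x⁆ i))) (x∈p∪q⁺ (inj₂ (x∈⁅x⁆ j))) ⟩
    xorBelow ((pairMon i j [ i ]≔ false) [ j ]≔ false) (λ _ → true)
      ≡⟨ cong (λ m → xorBelow m (λ _ → true)) (pairMon-remove i≢j) ⟩
    xorBelow {n} ⊥ (λ _ → true)
      ≡⟨ xorBelow-⊥ {n} (λ _ → true) ⟩
    true
      ∎

  flat⇒anf≡false : ∀ {p} → Flat (HH i j (signVec p)) →
    ∀ m → i ∈ m → j ∈ m → m ≢ pairMon i j → anf p m ≡ false
  flat⇒anf≡false flat m i∈m j∈m m≢ij = trans (anf-pair≡xorBelow-true flat m i∈m j∈m)
    (xorBelow-const ((m [ i ]≔ false) [ j ]≔ false) true (m≢ij ∘ remove-pair≡⊥⇒≡pairMon m i≢j i∈m j∈m))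

  HH≡signVec-pivot : ∀ {p} Ni Nj R → Indep i j Ni → Indep i j Nj → Indep i j R →
    (∀ x → p x ≡ decomp i j Ni Nj R x) → ∀ x → HH i j (signVec p) x ≡ signVec (pivot i j Ni Nj R) x
  HH≡signVec-pivot {p} Ni Nj R Ni-indep Nj-indep R-indep p≡decomp x = begin
    HH i j (signVec p) x
      ≡⟨ HH-gaussSum p x ⟩
    gaussSum (λ a b → (s ∧ a) xor ((t ∧ b) xor p (plane i j x a b)))
      ≡⟨ gaussSum-cong (λ a b → cong (λ y → (s ∧ a) xor ((t ∧ b) xor y))
           (trans (p≡decomp (plane i j x a b)) (decomp-plane Ni-indep Nj-indep R-indep x a b))) ⟩
    gaussSum (λ a b → (s ∧ a) xor ((t ∧ b) xor (((a ∧ b) xor (a ∧ Ni x)) xor ((b ∧ Nj x) xor R x))))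
      ≡⟨ gaussSum-cong (λ a b → phases-absorbed s t a b (Ni x) (Nj x) (R x)) ⟩
    gaussSum (λ a b → ((a ∧ b) xor (a ∧ (s xor Ni x))) xor ((b ∧ (t xor Nj x)) xor R x))
      ≡⟨ gaussSum-quadratic (s xor Ni x) (t xor Nj x) (R x) ⟩
    sgn (((s xor Ni x) ∧ (t xor Nj x)) xor R x)
      ≡⟨ cong sgn (pivot-expanded s t (Ni x) (Nj x) (R x)) ⟩
    signVec (pivot i j Ni Nj R) x
      ∎
    where
    s t : Bool
    s = lookup x i
    t = lookup x j

theorem5 : (n : ℕ) (p : BoolFn n) (i j : Fin n) → i ≢ j →
    Flat (HH i j (signVec p)) →
    (IsTerm p (pairMon i j)
      × (∀ (m : Subset n) → i ∈ m → j ∈ m → m ≢ pairMon i j → anf p m ≡ false))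
    × (∀ (Ni Nj R : BoolFn n) → Indep i j Ni → Indep i j Nj → Indep i j R →
         (∀ x → p x ≡ decomp i j Ni Nj R x) →
         ∀ x → HH i j (signVec p) x ≡ signVec (pivot i j Ni Nj R) x)
theorem5 n p i j i≢j flat =
  (flat⇒IsTerm-pairMon i≢j flat , flat⇒anf≡false i≢j flat) , HH≡signVec-pivot i≢j
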